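{- Let $p$ be an odd prime, let $n$ be an integer with $n\ge 2p-1$, and let $M$ be an $n$-spike with tip $t$ and lines $L_1,\dots,L_n$ that is representable over $GF(p)$ and over a finite field $F$ of characteristic $q$. Fix elements $b_i\in L_i\setminus\{t\}$ forming a basis, and let $c_i$ denote the conjugate of $b_i$. Let $A_1$ and $A_2$ be special standard representations of $M$ over $GF(p)$ and over $F$ respectively, both with respect to the distinguished basis $\{b_1,\dots,b_n\}$ (so in both, column $i$ is $b_i$, column $n+1$ is $t$, and column $n+1+i$ is $c_i$), with diagonals $\vec x=(-1,x_2,\dots,x_n)$ over $GF(p)$ and $\vec y=(y_1,\dots,y_n)$ over $F$. Let $m$ be a nonzero integer with $|m|\le (p-1)/2$, and let $I\subseteq\{2,\dots,n\}$ satisfy $|I|\le p-1$ and $\sum_{i\in I}x_i^{ -1}=m$ in $GF(p)$. Then $\sum_{i\in I}y_i^{ -1}=m$ in $F$.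
   Context: For an integer $n\ge 3$, a matroid $M$ is an $n$-spike (with tip $t$) if (i) its ground set is the union of $n$ lines $L_1,\dots,L_n$, each having exactly three points and all passing through a common point $t$; (ii) $r(L_1\cup\cdots\cup L_k)=k+1$ for all $k\in\{1,\dots,n-1\}$; and (iii) $r(L_1\cup\cdots\cup L_n)=n$. Two non-tip elements on the same line $L_i$ are called conjugate. If $M$ is representable over a field $F$ and $\{b_1,\dots,b_n\}$ is a basis with $b_i\in L_i\setminus\{t\}$ (the distinguished basis), then $M$ is represented over $F$ by an $n\times(2n+1)$ matrix $[I_n\mid \mathbf{1}\mid B]$, where column $i$ ($1\le i\le n$) corresponds to $b_i$, column $n+1$ is the all-ones vector and corresponds to the tip $t$, and column $n+1+i$ corresponds to the conjugate $c_i$ of $b_i$ and equals the all-ones vector plus $x_i$ times the $i$-th standard unit vector, where $x_i\in F$ (necessarily $x_i\ne 0$). Such a matrix is a special standard representation and $(x_1,\dots,x_n)$ is its diagonal. An integer $m$ is interpreted in a field via the canonical map $\mathbb{Z}\to$ field. -}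

module Defs where

open import Level using (Level; _⊔_) renaming (suc to lsuc)
open import Algebra.Bundles using (CommutativeRing)
open import Data.Nat as ℕ using (ℕ; zero; suc; _<_; _≤_)
open import Data.Integer as ℤ using (ℤ; +_; -[1+_])
open import Data.Fin as Fin using (Fin; zero; suc; toℕ; _↑ˡ_; _↑ʳ_; splitAt; _≟_)
open import Data.Fin.Subset using (Subset; ⊤; ⊥; ⁅_⁆; _∪_; ⋃; _∈_; _∉_; _⊆_; ∣_∣)
open import Data.Vec as Vec using (lookup)
open import Data.List as List using (List; allFin; filter)
open import Data.Bool using (Bool; true; false; if_then_else_)
open import Data.Sum using (_⊎_; inj₁; inj₂; [_,_]′)
open import Data.Product using (Σ; ∃; ∃-syntax; _×_; _,_)
open import Relation.Nullary using (¬_; does)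
open import Relation.Binary.PropositionalEquality using (_≡_)

-- The inverse operation is total;
-- its value at 0 is irrelevant (only used at nonzero elements).

record Field (c ℓ : Level) : Set (lsuc (c ⊔ ℓ)) where
  field
    commutativeRing : CommutativeRing c ℓ
  open CommutativeRing commutativeRing public hiding (zero)
  field
    _⁻¹        : Carrier → Carrier
    1≉0        : ¬ (1# ≈ 0#)
    ⁻¹-inverse : ∀ x → ¬ (x ≈ 0#) → (x * (x ⁻¹)) ≈ 1#

  fromℕ : ℕ → Carrier
  fromℕ zero    = 0#
  fromℕ (suc k) = 1# + fromℕ k

  fromℤ : ℤ → Carrier
  fromℤ (+ k)      = fromℕ k
  fromℤ -[1+ k ]   = - fromℕ (suc k)

  ∑ : ∀ {N} → (Fin N → Carrier) → Carrier
  ∑ {zero}  f = 0#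
  ∑ {suc N} f = f zero + ∑ (λ i → f (suc i))

  ∑∈ : ∀ {N} → Subset N → (Fin N → Carrier) → Carrier
  ∑∈ S f = ∑ (λ i → if lookup S i then f i else 0#)

module _ {c ℓ : Level} (K : Field c ℓ) where
  open Field K

  HasSize : ℕ → Set (c ⊔ ℓ)
  HasSize k = Σ (Fin k → Carrier) λ f →
                (∀ i j → f i ≈ f j → i ≡ j) × (∀ x → ∃[ i ] (f i ≈ x))

  IsFiniteField : Set (c ⊔ ℓ)
  IsFiniteField = ∃[ k ] HasSize k

  HasCharacteristic : ℕ → Set ℓ
  HasCharacteristic q =
    (0 < q) × (fromℕ q ≈ 0#) × (∀ m → 0 < m → m < q → ¬ (fromℕ m ≈ 0#))

  Matrix : ℕ → ℕ → Set c
  Matrix r N = Fin r → Fin N → Carrier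

  ColumnsIndependent : ∀ {r N} → Matrix r N → Subset N → Set (c ⊔ ℓ)
  ColumnsIndependent {N = N} A S =
    ∀ (λ' : Fin N → Carrier) →
      (∀ row → ∑∈ S (λ j → λ' j * A row j) ≈ 0#) →
      ∀ j → j ∈ S → λ' j ≈ 0#

record Matroid (N : ℕ) : Set₁ where
  field
    Indep   : Subset N → Set
    indep-∅ : Indep ⊥
    indep-⊆ : ∀ {X Y} → X ⊆ Y → Indep Y → Indep X
    indep-augment : ∀ {X Y} → Indep X → Indep Y → ∣ X ∣ < ∣ Y ∣ →
                    ∃[ e ] (e ∈ Y × e ∉ X × Indep (X ∪ ⁅ e ⁆))

module _ {N : ℕ} (M : Matroid N) where
  open Matroid M

  HasRank : Subset N → ℕ → Set
  HasRank X k = (∃[ Y ] (Y ⊆ X × Indep Y × ∣ Y ∣ ≡ k))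
              × (∀ Y → Y ⊆ X → Indep Y → ∣ Y ∣ ≤ k)

  IsBasis : Subset N → Set
  IsBasis B = Indep B × (∀ Y → Indep Y → B ⊆ Y → Y ⊆ B)

Represents : ∀ {c ℓ} (K : Field c ℓ) {r N} → Matrix K r N → Matroid N → Set (c ⊔ ℓ)
Represents K A M = ∀ S → (Matroid.Indep M S → ColumnsIndependent K A S)
                       × (ColumnsIndependent K A S → Matroid.Indep M S)

-- Ground set of an n-spike with distinguished basis, labelled by the
-- 2n+1 columns of a special standard representation:
--   b i  = column i           (i = 1..n)
--   t    = column n+1
--   c i  = column n+1+i
-- (Fin is 0-based, so paper index i corresponds to Fin index i-1.)

Ground : ℕ → ℕ
Ground n = n ℕ.+ suc n

bE : ∀ {n} → Fin n → Fin (Ground n)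
bE {n} i = i ↑ˡ suc n

tE : ∀ {n} → Fin (Ground n)
tE {n} = n ↑ʳ zero

cE : ∀ {n} → Fin n → Fin (Ground n)
cE {n} i = n ↑ʳ suc i

Line : ∀ {n} → Fin n → Subset (Ground n)
Line i = ⁅ bE i ⁆ ∪ ⁅ tE ⁆ ∪ ⁅ cE i ⁆

FirstLines : ∀ n → ℕ → Subset (Ground n)
FirstLines n k = ⋃ (List.map Line (filter (λ i → toℕ i ℕ.<? k) (allFin n)))

DistBasis : ∀ n → Subset (Ground n)
DistBasis n = ⋃ (List.map (λ i → ⁅ bE i ⁆) (allFin n))

-- M is an n-spike with tip t and lines L_i = {b_i, t, c_i}.
-- (The ground set Fin (2n+1) is the union of the lines by construction.)
IsSpike : ∀ n → Matroid (Ground n) → Set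
IsSpike n M =
    (3 ≤ n)
  × (∀ i → HasRank M (Line i) 2)
  × (∀ k → 1 ≤ k → k ≤ n ℕ.∸ 1 → HasRank M (FirstLines n k) (suc k))
  × HasRank M ⊤ n

module _ {c ℓ : Level} (K : Field c ℓ) where
  open Field K

  unit : ∀ {n} → Fin n → Fin n → Carrier
  unit i row = if does (i ≟ row) then 1# else 0#

  -- entry (row, column j) of [I_n | 1 | B] with diagonal x
  ssrEntry : ∀ {n} → (Fin n → Carrier) → Fin n → Fin (Ground n) → Carrier
  ssrEntry {n} x row j =
    [ (λ i → unit i row)
    , (λ { zero → 1# ; (suc i) → 1# + x i * unit i row })
    ]′ (splitAt n j)

  IsSpecialStandard : ∀ {n} → Matrix K n (Ground n) → (Fin n → Carrier) → Set ℓ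
  IsSpecialStandard A x =
    (∀ i → ¬ (x i ≈ 0#)) × (∀ row j → A row j ≈ ssrEntry x row j)

-- The columns {b_k : k ∉ J} ∪ {c_j : j ∈ J} of a special standard representation with
-- diagonal x are dependent exactly when ∑_{j∈J} x_j⁻¹ = -1.  As A₁ and A₂ represent the same
-- matroid, ∑_J x⁻¹ = -1 in GF(p) forces ∑_J y⁻¹ = -1 in F; since x_1 = -1, zero sums over sets
-- avoiding index 1 transfer as well.
-- In GF(p) the subset sums of any p − 1 nonzero elements cover the field: each new summand
-- enlarges the set of sums unless it is already everything.  As n ≥ 2p − 1 there are disjoint
-- sets D, E of p − 1 indices other than 1, with E disjoint from I.  By induction on k, a subset
-- of E summing to −k in GF(p) sums to −k in F: complete it by a subset A of D summing to k to a
-- (−1)-sum, where A in turn is completed by a subset of E summing to −k to a zero sum.  The same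
-- completion transfers ∑_I x⁻¹ = k; with I = ∅ and k = p it gives p = 0 in F, and a negative m
-- is replaced by p − ∣m∣.

module Submission where

open import Defs
open import Level using (Level; _⊔_)
import Algebra.Properties.Group as GroupProperties
import Algebra.Properties.Ring as RingProperties
import Algebra.Properties.Semiring.Sum as SemiringSum
import Algebra.Properties.Semiring.Mult as SemiringMult
import Algebra.Properties.CommutativeSemigroup as CommutativeSemigroupProperties
open import Data.Nat as ℕ using (ℕ; zero; suc; _<_; _≤_; z≤n; s≤s; _∸_)
import Data.Nat.Properties as ℕ
open import Data.Nat.GCD using (gcd; gcd-GCD; gcd[m,n]∣m; gcd[m,n]∣n; module Bézout)
open import Data.Nat.Divisibility using (∣⇒≤)
open import Data.Nat.Primality using (Prime; prime⇒irreducible)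
open import Data.Integer as ℤ using (ℤ; -[1+_])
open import Data.Fin as Fin using (Fin; zero; suc; toℕ; _↑ˡ_; _↑ʳ_; splitAt)
import Data.Fin.Properties as Fin
open import Data.Fin.Permutation using (Permutation′; _⟨$⟩ʳ_; permutation)
open import Data.Fin.Subset as Subset
  using (Subset; inside; outside; _∈_; _∉_; _⊆_; _⊂_; _∪_; _─_; ∁; ⁅_⁆; ⊥; ⊤)
  renaming (∣_∣ to size)
import Data.Fin.Subset.Properties as Subset
open import Data.Vec as Vec using ([]; _∷_; lookup; _++_; here; there)
import Data.Vec.Properties as Vec
open import Data.Bool using (true; false; not; if_then_else_; _∨_)
open import Data.Sum using (_⊎_; inj₁; inj₂; [_,_]′)
open import Data.Product using (∃; ∃-syntax; _×_; _,_; proj₁; proj₂)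
open import Data.Empty using (⊥-elim)
open import Function using (_∘_)
open import Relation.Nullary using (¬_; ¬?; Dec; yes; no; _×-dec_)
open import Relation.Nullary.Negation using (contradiction)
open import Relation.Binary.PropositionalEquality as ≡ using (_≡_; _≢_)
open import Relation.Binary.Definitions using (tri<; tri≈; tri>)

Disjoint : ∀ {n} → Subset n → Subset n → Set
Disjoint S T = ∀ {i} → i ∈ S → i ∉ T

⊆-∪ : ∀ {n} {S T U : Subset n} → S ⊆ U → T ⊆ U → S ∪ T ⊆ U
⊆-∪ {S = S} {T} S⊆U T⊆U x∈S∪T = [ S⊆U , T⊆U ]′ (Subset.x∈p∪q⁻ S T x∈S∪T)

∈─⇒∉ : ∀ {n} {S T : Subset n} {i} → i ∈ S ─ T → i ∉ T
∈─⇒∉ {S = _ ∷ _} {inside ∷ _} () here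
∈─⇒∉ {S = _ ∷ _} {_ ∷ _} (there i∈S─T) (there i∈T) = ∈─⇒∉ i∈S─T i∈T

∈-++⁺ʳ : ∀ {m n} (S : Subset m) {T : Subset n} {j} → j ∈ T → m ↑ʳ j ∈ S ++ T
∈-++⁺ʳ []      j∈T = j∈T
∈-++⁺ʳ (_ ∷ S) j∈T = there (∈-++⁺ʳ S j∈T)

∈-++⁻ : ∀ {m n} (S : Subset m) (T : Subset n) {g} → g ∈ S ++ T →
        (∃[ i ] i ∈ S × g ≡ i ↑ˡ n) ⊎ (∃[ j ] j ∈ T × g ≡ m ↑ʳ j)
∈-++⁻ []      T g∈T              = inj₂ (_ , g∈T , ≡.refl)
∈-++⁻ (_ ∷ S) T here             = inj₁ (zero , here , ≡.refl)
∈-++⁻ (_ ∷ S) T (there g∈S++T) with ∈-++⁻ S T g∈S++T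
... | inj₁ (i , i∈S , ≡.refl) = inj₁ (suc i , there i∈S , ≡.refl)
... | inj₂ (j , j∈T , ≡.refl) = inj₂ (j , j∈T , ≡.refl)

∣∁⁅i⁆∣≡n∸1 : ∀ {n} (i : Fin n) → size (∁ ⁅ i ⁆) ≡ n ∸ 1
∣∁⁅i⁆∣≡n∸1 {n} i = ≡.trans (Subset.∣∁p∣≡n∸∣p∣ ⁅ i ⁆) (≡.cong (n ∸_) (Subset.∣⁅x⁆∣≡1 i))

∣S∣≤∣S─T∣+∣T∣ : ∀ {n} (S T : Subset n) → size S ≤ size (S ─ T) ℕ.+ size T
∣S∣≤∣S─T∣+∣T∣ []            []            = z≤n
∣S∣≤∣S─T∣+∣T∣ (inside ∷ S)  (inside ∷ T)  =
  ≡.subst (suc (size S) ≤_) (≡.sym (ℕ.+-suc _ _)) (s≤s (∣S∣≤∣S─T∣+∣T∣ S T))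
∣S∣≤∣S─T∣+∣T∣ (outside ∷ S) (inside ∷ T)  =
  ℕ.≤-trans (∣S∣≤∣S─T∣+∣T∣ S T) (ℕ.+-monoʳ-≤ (size (S ─ T)) (ℕ.n≤1+n _))
∣S∣≤∣S─T∣+∣T∣ (inside ∷ S)  (outside ∷ T) = s≤s (∣S∣≤∣S─T∣+∣T∣ S T)
∣S∣≤∣S─T∣+∣T∣ (outside ∷ S) (outside ∷ T) = ∣S∣≤∣S─T∣+∣T∣ S T

∣S─T∣-lowerBound : ∀ {n k l} (S T : Subset n) → k ℕ.+ l ≤ size S → size T ≤ l → k ≤ size (S ─ T)
∣S─T∣-lowerBound {k = k} {l} S T k+l≤S T≤l = ℕ.+-cancelʳ-≤ l k (size (S ─ T))
  (ℕ.≤-trans k+l≤S (ℕ.≤-trans (∣S∣≤∣S─T∣+∣T∣ S T) (ℕ.+-monoʳ-≤ (size (S ─ T)) T≤l)))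

⊆-withSize : ∀ {n} (T : Subset n) k → k ≤ size T → ∃[ E ] E ⊆ T × size E ≡ k
⊆-withSize         []            zero    _         = [] , (λ ()) , ≡.refl
⊆-withSize         (outside ∷ T) k       k≤∣T∣     with ⊆-withSize T k k≤∣T∣
... | E , E⊆T , ∣E∣≡k = outside ∷ E , Subset.out⊆ E⊆T , ∣E∣≡k
⊆-withSize {suc n} (inside ∷ T)  zero    _         = ⊥ , (⊥-elim ∘ Subset.∉⊥) , Subset.∣⊥∣≡0 (suc n)
⊆-withSize         (inside ∷ T)  (suc k) (s≤s k≤∣T∣) with ⊆-withSize T k k≤∣T∣
... | E , E⊆T , ∣E∣≡k = inside ∷ E , Subset.s⊆s E⊆T , ≡.cong suc ∣E∣≡k

disjointBlocks : ∀ {n k} (U I : Subset n) → k ℕ.+ k ≤ size U → size I ≤ k →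
                 ∃[ D ] ∃[ E ] D ⊆ U × E ⊆ U × Disjoint D E × Disjoint I E × k ≤ size D × k ≤ size E
disjointBlocks {k = k} U I 2k≤∣U∣ ∣I∣≤k
  with ⊆-withSize (U ─ I) k (∣S─T∣-lowerBound U I 2k≤∣U∣ ∣I∣≤k)
... | E , E⊆U─I , ∣E∣≡k =
  U ─ E , E , Subset.p─q⊆p U E , Subset.p─q⊆p U I ∘ E⊆U─I , ∈─⇒∉ ,
  (λ i∈I i∈E → ∈─⇒∉ (E⊆U─I i∈E) i∈I) ,
  ∣S─T∣-lowerBound U E 2k≤∣U∣ (ℕ.≤-reflexive ∣E∣≡k) , ℕ.≤-reflexive (≡.sym ∣E∣≡k)

Fin-injective⇒surjective : ∀ {n} {f : Fin n → Fin n} → (∀ {x y} → f x ≡ f y → x ≡ y) →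
                           ∀ y → ∃[ x ] f x ≡ y
Fin-injective⇒surjective {suc n} {f} f-injective y with Fin.any? (λ x → f x Fin.≟ y)
... | yes hit = hit
... | no miss = contradiction (Fin.injective⇒≤ f′-injective) ℕ.1+n≰n
  where
  y≢f : ∀ x → y ≢ f x
  y≢f x y≡fx = miss (x , ≡.sym y≡fx)
  f′ : Fin (suc n) → Fin n
  f′ x = Fin.punchOut (y≢f x)
  f′-injective : ∀ {x x′} → f′ x ≡ f′ x′ → x ≡ x′
  f′-injective {x} {x′} = f-injective ∘ Fin.punchOut-injective (y≢f x) (y≢f x′)

-- The representative of m modulo p in [0, p], provided ∣ m ∣ ≤ p.
residue : ℕ → ℤ → ℕ
residue p (ℤ.+ k)  = k
residue p -[1+ k ] = p ∸ suc k

module FieldProperties {c ℓ : Level} (K : Field c ℓ) where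

  open Field K
  open import Relation.Binary.Reasoning.Setoid setoid
  open SemiringSum semiring
    using (sum; sum-cong-≋; *-distribˡ-sum; sum-permute) renaming (∑-distrib-+ to sum-distrib-+)
  open SemiringMult semiring using (×-homo-+; ×1-homo-*) renaming (_×_ to _·_)
  open GroupProperties +-group using (inverseʳ-unique; ⁻¹-involutive; ε⁻¹≈ε; ⁻¹-anti-homo-∙)
  open RingProperties ring using (-1*x≈-x)
  open CommutativeSemigroupProperties +-commutativeSemigroup using (interchange)

  x≉0⇒x⁻¹≉0 : ∀ {x} → ¬ x ≈ 0# → ¬ x ⁻¹ ≈ 0#
  x≉0⇒x⁻¹≉0 {x} x≉0 x⁻¹≈0 = 1≉0 (begin
    1#         ≈⟨ ⁻¹-inverse x x≉0 ⟨
    x * x ⁻¹   ≈⟨ *-congˡ x⁻¹≈0 ⟩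
    x * 0#     ≈⟨ zeroʳ x ⟩
    0#         ∎)

  x≉0∧x*y≈0⇒y≈0 : ∀ {x y} → ¬ x ≈ 0# → x * y ≈ 0# → y ≈ 0#
  x≉0∧x*y≈0⇒y≈0 {x} {y} x≉0 xy≈0 = begin
    y                ≈⟨ *-identityˡ y ⟨
    1# * y           ≈⟨ *-congʳ (trans (*-comm _ _) (⁻¹-inverse x x≉0)) ⟨
    (x ⁻¹ * x) * y   ≈⟨ *-assoc _ _ _ ⟩
    x ⁻¹ * (x * y)   ≈⟨ *-congˡ xy≈0 ⟩
    x ⁻¹ * 0#        ≈⟨ zeroʳ _ ⟩
    0#               ∎

  x≈-1⇒x⁻¹≈-1 : ∀ {x} → x ≈ - 1# → x ⁻¹ ≈ - 1#
  x≈-1⇒x⁻¹≈-1 {x} x≈-1 = begin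
    x ⁻¹             ≈⟨ ⁻¹-involutive _ ⟨
    - (- (x ⁻¹))     ≈⟨ -‿cong (-1*x≈-x _) ⟨
    - (- 1# * x ⁻¹)  ≈⟨ -‿cong (*-congʳ x≈-1) ⟨
    - (x * x ⁻¹)     ≈⟨ -‿cong (⁻¹-inverse x x≉0) ⟩
    - 1#             ∎
    where
    x≉0 : ¬ x ≈ 0#
    x≉0 x≈0 = 1≉0 (begin
      1#         ≈⟨ ⁻¹-involutive 1# ⟨
      - (- 1#)   ≈⟨ -‿cong (trans (sym x≈-1) x≈0) ⟩
      - 0#       ≈⟨ ε⁻¹≈ε ⟩
      0#         ∎)

  fromℕ≡×1 : ∀ k → fromℕ k ≡ k · 1#
  fromℕ≡×1 zero    = ≡.refl
  fromℕ≡×1 (suc k) = ≡.cong (1# +_) (fromℕ≡×1 k)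

  fromℕ-+ : ∀ m n → fromℕ (m ℕ.+ n) ≈ fromℕ m + fromℕ n
  fromℕ-+ m n
    rewrite fromℕ≡×1 (m ℕ.+ n) | fromℕ≡×1 m | fromℕ≡×1 n = ×-homo-+ 1# m n

  fromℕ-* : ∀ m n → fromℕ (m ℕ.* n) ≈ fromℕ m * fromℕ n
  fromℕ-* m n
    rewrite fromℕ≡×1 (m ℕ.* n) | fromℕ≡×1 m | fromℕ≡×1 n = ×1-homo-* m n

  fromℕ-*≈0 : ∀ m {n} → fromℕ n ≈ 0# → fromℕ (m ℕ.* n) ≈ 0#
  fromℕ-*≈0 m {n} n≈0 = begin
    fromℕ (m ℕ.* n)     ≈⟨ fromℕ-* m n ⟩
    fromℕ m * fromℕ n   ≈⟨ *-congˡ n≈0 ⟩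
    fromℕ m * 0#        ≈⟨ zeroʳ _ ⟩
    0#                  ∎

  fromℕ-+≈0 : ∀ m {n} → fromℕ n ≈ 0# → fromℕ (m ℕ.+ n) ≈ fromℕ m
  fromℕ-+≈0 m {n} n≈0 = begin
    fromℕ (m ℕ.+ n)     ≈⟨ fromℕ-+ m n ⟩
    fromℕ m + fromℕ n   ≈⟨ +-congˡ n≈0 ⟩
    fromℕ m + 0#        ≈⟨ +-identityʳ _ ⟩
    fromℕ m             ∎

  fromℕ-gcd≈0 : ∀ {m n} → fromℕ m ≈ 0# → fromℕ n ≈ 0# → fromℕ (gcd m n) ≈ 0#
  fromℕ-gcd≈0 {m} {n} m≈0 n≈0 with Bézout.identity (gcd-GCD m n)
  ... | Bézout.+- x y eq = begin
    fromℕ (gcd m n)                 ≈⟨ fromℕ-+≈0 (gcd m n) (fromℕ-*≈0 y n≈0) ⟨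
    fromℕ (gcd m n ℕ.+ y ℕ.* n)     ≡⟨ ≡.cong fromℕ eq ⟩
    fromℕ (x ℕ.* m)                 ≈⟨ fromℕ-*≈0 x m≈0 ⟩
    0#                              ∎
  ... | Bézout.-+ x y eq = begin
    fromℕ (gcd m n)                 ≈⟨ fromℕ-+≈0 (gcd m n) (fromℕ-*≈0 x m≈0) ⟨
    fromℕ (gcd m n ℕ.+ x ℕ.* m)     ≡⟨ ≡.cong fromℕ eq ⟩
    fromℕ (y ℕ.* n)                 ≈⟨ fromℕ-*≈0 y n≈0 ⟩
    0#                              ∎

  x+a-a≈x : ∀ x a → (x + a) + - a ≈ x
  x+a-a≈x x a = begin
    (x + a) + - a    ≈⟨ +-assoc _ _ _ ⟩
    x + (a + - a)    ≈⟨ +-congˡ (-‿inverseʳ a) ⟩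
    x + 0#           ≈⟨ +-identityʳ x ⟩
    x                ∎

  x-a+a≈x : ∀ x a → (x + - a) + a ≈ x
  x-a+a≈x x a = begin
    (x + - a) + a    ≈⟨ +-assoc _ _ _ ⟩
    x + (- a + a)    ≈⟨ +-congˡ (-‿inverseˡ a) ⟩
    x + 0#           ≈⟨ +-identityʳ x ⟩
    x                ∎

  x+-[1+x]≈-1 : ∀ x → x + - (1# + x) ≈ - 1#
  x+-[1+x]≈-1 x = begin
    x + - (1# + x)      ≈⟨ +-congˡ (⁻¹-anti-homo-∙ 1# x) ⟩
    x + (- x + - 1#)    ≈⟨ +-assoc _ _ _ ⟨
    (x + - x) + - 1#    ≈⟨ +-congʳ (-‿inverseʳ x) ⟩
    0# + - 1#           ≈⟨ +-identityˡ _ ⟩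
    - 1#                ∎

  fromℤ≈fromℕ-residue : ∀ {p} → fromℕ p ≈ 0# → ∀ m → ℤ.∣ m ∣ ≤ p → fromℤ m ≈ fromℕ (residue p m)
  fromℤ≈fromℕ-residue         p≈0 (ℤ.+ k)  _     = refl
  fromℤ≈fromℕ-residue {p} p≈0 -[1+ k ] 1+k≤p = sym (inverseʳ-unique (fromℕ (suc k)) _ (begin
    fromℕ (suc k) + fromℕ (p ∸ suc k)   ≈⟨ fromℕ-+ (suc k) (p ∸ suc k) ⟨
    fromℕ (suc k ℕ.+ (p ∸ suc k))       ≡⟨ ≡.cong fromℕ (ℕ.m+[n∸m]≡n 1+k≤p) ⟩
    fromℕ p                             ≈⟨ p≈0 ⟩
    0#                                  ∎))

  ∑≡sum : ∀ {N} (f : Fin N → Carrier) → ∑ f ≡ sum f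
  ∑≡sum {zero}  f = ≡.refl
  ∑≡sum {suc N} f = ≡.cong (f zero +_) (∑≡sum (f ∘ suc))

  ∑1≡fromℕ : ∀ N → ∑ {N} (λ _ → 1#) ≡ fromℕ N
  ∑1≡fromℕ zero    = ≡.refl
  ∑1≡fromℕ (suc N) = ≡.cong (1# +_) (∑1≡fromℕ N)

  ∑-permute : ∀ {N} (f : Fin N → Carrier) (π : Permutation′ N) → ∑ f ≈ ∑ (f ∘ (π ⟨$⟩ʳ_))
  ∑-permute f π rewrite ∑≡sum f | ∑≡sum (f ∘ (π ⟨$⟩ʳ_)) = sum-permute f π

  ∑-cong : ∀ {N} {f g : Fin N → Carrier} → (∀ i → f i ≈ g i) → ∑ f ≈ ∑ g
  ∑-cong {f = f} {g} f≈g rewrite ∑≡sum f | ∑≡sum g = sum-cong-≋ f≈g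

  ∑-distrib-+ : ∀ {N} (f g : Fin N → Carrier) → ∑ (λ i → f i + g i) ≈ ∑ f + ∑ g
  ∑-distrib-+ f g rewrite ∑≡sum (λ i → f i + g i) | ∑≡sum f | ∑≡sum g = sum-distrib-+ f g

  *-distribˡ-∑ : ∀ {N} x (f : Fin N → Carrier) → x * ∑ f ≈ ∑ (λ i → x * f i)
  *-distribˡ-∑ x f rewrite ∑≡sum f | ∑≡sum (λ i → x * f i) = *-distribˡ-sum x f

  ∑∈-cong : ∀ {N} (S : Subset N) {f g : Fin N → Carrier} →
            (∀ {i} → i ∈ S → f i ≈ g i) → ∑∈ S f ≈ ∑∈ S g
  ∑∈-cong S f≈g = ∑-cong pointwise
    where
    pointwise : ∀ i → (if lookup S i then _ else 0#) ≈ (if lookup S i then _ else 0#)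
    pointwise i with lookup S i in i∈S
    ... | true  = f≈g (Vec.lookup⇒[]= i S i∈S)
    ... | false = refl

  ∑∈-zero : ∀ {N} (S : Subset N) {f : Fin N → Carrier} →
            (∀ {i} → i ∈ S → f i ≈ 0#) → ∑∈ S f ≈ 0#
  ∑∈-zero []            f≈0 = refl
  ∑∈-zero (inside ∷ S)  f≈0 = trans (+-cong (f≈0 here) (∑∈-zero S (f≈0 ∘ there))) (+-identityʳ 0#)
  ∑∈-zero (outside ∷ S) f≈0 = trans (+-identityˡ _) (∑∈-zero S (f≈0 ∘ there))

  ∑∈-⊥ : ∀ {N} (f : Fin N → Carrier) → ∑∈ ⊥ f ≈ 0#
  ∑∈-⊥ f = ∑∈-zero ⊥ {f} (⊥-elim ∘ Subset.∉⊥)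

  ∑∈-⁅⁆ : ∀ {N} (i : Fin N) (f : Fin N → Carrier) → ∑∈ ⁅ i ⁆ f ≈ f i
  ∑∈-⁅⁆ zero    f = trans (+-congˡ (∑∈-⊥ (f ∘ suc))) (+-identityʳ _)
  ∑∈-⁅⁆ (suc i) f = trans (+-identityˡ _) (∑∈-⁅⁆ i (f ∘ suc))

  ∑∈-∪ : ∀ {N} (S T : Subset N) (f : Fin N → Carrier) →
         Disjoint S T → ∑∈ (S ∪ T) f ≈ ∑∈ S f + ∑∈ T f
  ∑∈-∪ []      []      f S∩T=∅ = sym (+-identityʳ 0#)
  ∑∈-∪ (s ∷ S) (t ∷ T) f S∩T=∅ = trans
    (+-cong (head s t S∩T=∅) (∑∈-∪ S T (f ∘ suc) (λ i∈S i∈T → S∩T=∅ (there i∈S) (there i∈T))))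
    (interchange _ _ _ _)
    where
    head : ∀ s t → Disjoint (s ∷ S) (t ∷ T) →
           (if s ∨ t then f zero else 0#) ≈ (if s then f zero else 0#) + (if t then f zero else 0#)
    head true  true  disj = contradiction here (disj here)
    head true  false _    = sym (+-identityʳ _)
    head false true  _    = sym (+-identityˡ _)
    head false false _    = sym (+-identityʳ 0#)

  ∑∈-++ : ∀ {m n} (S : Subset m) (T : Subset n) (f : Fin (m ℕ.+ n) → Carrier) →
          ∑∈ (S ++ T) f ≈ ∑∈ S (f ∘ (_↑ˡ n)) + ∑∈ T (f ∘ (m ↑ʳ_))
  ∑∈-++ []      T f = sym (+-identityˡ _)
  ∑∈-++ (s ∷ S) T f = trans (+-congˡ (∑∈-++ S T (f ∘ suc))) (sym (+-assoc _ _ _))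

  ∑∈-distrib-+ : ∀ {N} (S : Subset N) (f g : Fin N → Carrier) →
                 ∑∈ S (λ i → f i + g i) ≈ ∑∈ S f + ∑∈ S g
  ∑∈-distrib-+ S f g = trans (∑-cong pointwise)
    (∑-distrib-+ (λ i → if lookup S i then f i else 0#) (λ i → if lookup S i then g i else 0#))
    where
    pointwise : ∀ i → (if lookup S i then f i + g i else 0#) ≈
                      (if lookup S i then f i else 0#) + (if lookup S i then g i else 0#)
    pointwise i with lookup S i
    ... | true  = refl
    ... | false = sym (+-identityʳ 0#)

  *-distribˡ-∑∈ : ∀ {N} (S : Subset N) x (f : Fin N → Carrier) →
                  x * ∑∈ S f ≈ ∑∈ S (λ i → x * f i)
  *-distribˡ-∑∈ S x f = trans (*-distribˡ-∑ x (λ i → if lookup S i then f i else 0#)) (∑-cong pointwise)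
    where
    pointwise : ∀ i → x * (if lookup S i then f i else 0#) ≈ (if lookup S i then x * f i else 0#)
    pointwise i with lookup S i
    ... | true  = refl
    ... | false = zeroʳ x

  ∑∈-unit : ∀ {N} (S : Subset N) (g : Fin N → Carrier) (r : Fin N) →
            ∑∈ S (λ k → g k * unit K k r) ≈ (if lookup S r then g r else 0#)
  ∑∈-unit (s ∷ S) g zero = trans (+-cong (head s) (∑∈-zero S (λ _ → zeroʳ _))) (+-identityʳ _)
    where
    head : ∀ s → (if s then g zero * 1# else 0#) ≈ (if s then g zero else 0#)
    head true  = *-identityʳ _
    head false = refl
  ∑∈-unit (s ∷ S) g (suc r) = trans (+-cong (head s) (∑∈-unit S (g ∘ suc) r)) (+-identityˡ _)
    where
    head : ∀ s → (if s then g zero * 0# else 0#) ≈ 0#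
    head true  = zeroʳ _
    head false = refl

  SubsetSumsCover : ∀ {N} → Subset N → (Fin N → Carrier) → Set (c ⊔ ℓ)
  SubsetSumsCover T u = ∀ t → ∃[ A ] A ⊆ T × ∑∈ A u ≈ t

module Finite {c ℓ : Level} (K : Field c ℓ) {k : ℕ} (K-size : HasSize K k) where

  open Field K

  element : Fin k → Carrier
  element = proj₁ K-size

  element-injective : ∀ {i j} → element i ≈ element j → i ≡ j
  element-injective = proj₁ (proj₂ K-size) _ _

  index : Carrier → Fin k
  index x = proj₁ (proj₂ (proj₂ K-size) x)

  element-index : ∀ x → element (index x) ≈ x
  element-index x = proj₂ (proj₂ (proj₂ K-size) x)

  index-element : ∀ i → index (element i) ≡ i
  index-element i = element-injective (element-index (element i))

  index-cong : ∀ {x y} → x ≈ y → index x ≡ index y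
  index-cong {x} {y} x≈y = element-injective (trans (element-index x) (trans x≈y (sym (element-index y))))

  _≟_ : ∀ x y → Dec (x ≈ y)
  x ≟ y with index x Fin.≟ index y
  ... | yes ix≡iy =
    yes (trans (sym (element-index x)) (trans (reflexive (≡.cong element ix≡iy)) (element-index y)))
  ... | no  ix≢iy = no (ix≢iy ∘ index-cong)

module PrimeField {c ℓ : Level} (K : Field c ℓ) {p : ℕ} (p-prime : Prime p) (K-size : HasSize K p) where

  open Field K
  open FieldProperties K
  open Finite K K-size
  open GroupProperties +-group using (∙-cancelˡ)
  open import Relation.Binary.Reasoning.Setoid setoid

  translation : Carrier → Permutation′ p
  translation a = permutation (λ i → index (element i + a)) (λ i → index (element i + - a))
    (λ i → ≡.trans (index-cong (trans (+-congʳ (element-index _)) (x-a+a≈x _ a))) (index-element i))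
    (λ i → ≡.trans (index-cong (trans (+-congʳ (element-index _)) (x+a-a≈x _ a))) (index-element i))

  -- Translating every element by 1 permutes the field, so ∑ x = ∑ (x + 1) = ∑ x + p.
  fromℕ[p]≈0 : fromℕ p ≈ 0#
  fromℕ[p]≈0 = ∙-cancelˡ (∑ element) _ _ (begin
    ∑ element + fromℕ p                             ≡⟨ ≡.cong (∑ element +_) (∑1≡fromℕ p) ⟨
    ∑ element + ∑ {p} (λ _ → 1#)                    ≈⟨ ∑-distrib-+ element (λ _ → 1#) ⟨
    ∑ (λ i → element i + 1#)                        ≈⟨ ∑-cong (λ i → element-index (element i + 1#)) ⟨
    ∑ (element ∘ (translation 1# ⟨$⟩ʳ_))            ≈⟨ ∑-permute element (translation 1#) ⟨
    ∑ element                                       ≈⟨ +-identityʳ _ ⟨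
    ∑ element + 0#                                  ∎)

  fromℕ≉0 : ∀ {d} → 0 < d → d < p → ¬ fromℕ d ≈ 0#
  fromℕ≉0 {d} 0<d d<p d≈0 with prime⇒irreducible p-prime (gcd[m,n]∣m p d)
  ... | inj₁ gcd≡1 = 1≉0 (begin
    1#                ≈⟨ +-identityʳ 1# ⟨
    fromℕ 1           ≡⟨ ≡.cong fromℕ gcd≡1 ⟨
    fromℕ (gcd p d)   ≈⟨ fromℕ-gcd≈0 {p} {d} fromℕ[p]≈0 d≈0 ⟩
    0#                ∎)
  ... | inj₂ gcd≡p = ℕ.<⇒≱ d<p (≡.subst (_≤ d) gcd≡p (∣⇒≤ {{ℕ.>-nonZero 0<d}} (gcd[m,n]∣n p d)))

  <⇒fromℕ≉ : ∀ {i j} → i < j → j < p → ¬ fromℕ i ≈ fromℕ j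
  <⇒fromℕ≉ {i} {j} i<j j<p i≈j =
    fromℕ≉0 (ℕ.m<n⇒0<n∸m i<j) (ℕ.≤-<-trans (ℕ.m∸n≤m j i) j<p) (∙-cancelˡ (fromℕ i) _ _ (begin
      fromℕ i + fromℕ (j ∸ i)   ≈⟨ fromℕ-+ i (j ∸ i) ⟨
      fromℕ (i ℕ.+ (j ∸ i))     ≡⟨ ≡.cong fromℕ (ℕ.m+[n∸m]≡n (ℕ.<⇒≤ i<j)) ⟩
      fromℕ j                   ≈⟨ i≈j ⟨
      fromℕ i                   ≈⟨ +-identityʳ _ ⟨
      fromℕ i + 0#              ∎))

  fromℕ-injective : ∀ {i j} → i < p → j < p → fromℕ i ≈ fromℕ j → i ≡ j
  fromℕ-injective {i} {j} i<p j<p i≈j with ℕ.<-cmp i j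
  ... | tri< i<j _ _ = contradiction i≈j (<⇒fromℕ≉ i<j j<p)
  ... | tri≈ _ i≡j _ = i≡j
  ... | tri> _ _ j<i = contradiction (sym i≈j) (<⇒fromℕ≉ j<i i<p)

  private
    fromFin : Fin p → Fin p
    fromFin i = index (fromℕ (toℕ i))

    fromFin-injective : ∀ {i j} → fromFin i ≡ fromFin j → i ≡ j
    fromFin-injective {i} {j} eq = Fin.toℕ-injective (fromℕ-injective (Fin.toℕ<n i) (Fin.toℕ<n j) (begin
      fromℕ (toℕ i)             ≈⟨ element-index _ ⟨
      element (fromFin i)       ≡⟨ ≡.cong element eq ⟩
      element (fromFin j)       ≈⟨ element-index _ ⟩
      fromℕ (toℕ j)             ∎))

  fromℕ-surjective : ∀ x → ∃[ j ] fromℕ j ≈ x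
  fromℕ-surjective x with Fin-injective⇒surjective fromFin-injective (index x)
  ... | i , fromFin-i≡index-x = toℕ i , (begin
    fromℕ (toℕ i)          ≈⟨ element-index _ ⟨
    element (fromFin i)    ≡⟨ ≡.cong element fromFin-i≡index-x ⟩
    element (index x)      ≈⟨ element-index x ⟩
    x                      ∎)

  -- Sets of field elements are subsets of Fin p via index; R ⊕ a is the translate R + a.
  _⊕_ : Subset p → Carrier → Subset p
  R ⊕ a = Vec.tabulate (λ i → lookup R (index (element i + - a)))

  ∈⊕⁺ : ∀ {R x} a → index x ∈ R → index (x + a) ∈ R ⊕ a
  ∈⊕⁺ {R} {x} a x∈R = Vec.lookup⇒[]= _ _ (≡.trans (Vec.lookup∘tabulate _ (index (x + a)))
    (≡.trans (≡.cong (lookup R) (index-cong (trans (+-congʳ (element-index _)) (x+a-a≈x x a))))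
             (Vec.[]=⇒lookup x∈R)))

  ∈⊕⁻ : ∀ {R a i} → i ∈ R ⊕ a → index (element i + - a) ∈ R
  ∈⊕⁻ {R} {a} {i} i∈R⊕a =
    Vec.lookup⇒[]= _ _ (≡.trans (≡.sym (Vec.lookup∘tabulate _ i)) (Vec.[]=⇒lookup i∈R⊕a))

  -- A set containing 0 and closed under x ↦ x + a contains every j·a, and these are all elements.
  closed⇒full : ∀ {R a} → ¬ a ≈ 0# → index 0# ∈ R →
                (∀ {x} → index x ∈ R → index (x + a) ∈ R) → ∀ i → i ∈ R
  closed⇒full {R} {a} a≉0 0∈R closed i with fromℕ-surjective (element i * a ⁻¹)
  ... | j , j≈i/a = ≡.subst (_∈ R) (≡.trans (index-cong ja≈i) (index-element i)) (multiples j)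
    where
    multiples : ∀ j → index (fromℕ j * a) ∈ R
    multiples zero    = ≡.subst (_∈ R) (index-cong (sym (zeroˡ a))) 0∈R
    multiples (suc j) = ≡.subst (_∈ R) (index-cong (begin
      fromℕ j * a + a          ≈⟨ +-comm _ _ ⟩
      a + fromℕ j * a          ≈⟨ +-congʳ (*-identityˡ a) ⟨
      1# * a + fromℕ j * a     ≈⟨ distribʳ a 1# (fromℕ j) ⟨
      fromℕ (suc j) * a        ∎)) (closed (multiples j))
    ja≈i : fromℕ j * a ≈ element i
    ja≈i = begin
      fromℕ j * a              ≈⟨ *-congʳ j≈i/a ⟩
      (element i * a ⁻¹) * a   ≈⟨ *-assoc _ _ _ ⟩
      element i * (a ⁻¹ * a)   ≈⟨ *-congˡ (trans (*-comm _ _) (⁻¹-inverse a a≉0)) ⟩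
      element i * 1#           ≈⟨ *-identityʳ _ ⟩
      element i                ∎

  subsetSums : ∀ {N} → Subset N → (Fin N → Carrier) → Subset p
  subsetSums []            u = ⁅ index 0# ⁆
  subsetSums (outside ∷ T) u = subsetSums T (u ∘ suc)
  subsetSums (inside ∷ T)  u = subsetSums T (u ∘ suc) ∪ (subsetSums T (u ∘ suc) ⊕ u zero)

  subsetSums-sound : ∀ {N} (T : Subset N) u {i} → i ∈ subsetSums T u →
                     ∃[ A ] A ⊆ T × ∑∈ A u ≈ element i
  subsetSums-sound []            u i∈ =
    [] , (λ ()) ,
    trans (sym (element-index 0#)) (reflexive (≡.cong element (≡.sym (Subset.x∈⁅y⁆⇒x≡y _ i∈))))
  subsetSums-sound (outside ∷ T) u i∈ with subsetSums-sound T (u ∘ suc) i∈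
  ... | A , A⊆T , ∑A≈i = outside ∷ A , Subset.out⊆ A⊆T , trans (+-identityˡ _) ∑A≈i
  subsetSums-sound (inside ∷ T)  u i∈ with Subset.x∈p∪q⁻ _ _ i∈
  ... | inj₁ i∈R with subsetSums-sound T (u ∘ suc) i∈R
  ...   | A , A⊆T , ∑A≈i = outside ∷ A , Subset.out⊆ A⊆T , trans (+-identityˡ _) ∑A≈i
  subsetSums-sound (inside ∷ T)  u {i} i∈ | inj₂ i∈R⊕a with subsetSums-sound T (u ∘ suc) (∈⊕⁻ i∈R⊕a)
  ... | A , A⊆T , ∑A≈i-a = inside ∷ A , Subset.s⊆s A⊆T , (begin
    u zero + ∑∈ A (u ∘ suc)                           ≈⟨ +-congˡ (trans ∑A≈i-a (element-index _)) ⟩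
    u zero + (element i + - u zero)                   ≈⟨ +-comm _ _ ⟩
    (element i + - u zero) + u zero                   ≈⟨ x-a+a≈x _ _ ⟩
    element i                                         ∎)

  0∈subsetSums : ∀ {N} (T : Subset N) u → index 0# ∈ subsetSums T u
  0∈subsetSums []            u = Subset.x∈⁅x⁆ _
  0∈subsetSums (outside ∷ T) u = 0∈subsetSums T (u ∘ suc)
  0∈subsetSums (inside ∷ T)  u = Subset.p⊆p∪q _ (0∈subsetSums T (u ∘ suc))

  ⊕-grows : ∀ {R a} → ¬ a ≈ 0# → index 0# ∈ R → R ≡ ⊤ ⊎ R ⊂ R ∪ (R ⊕ a)
  ⊕-grows {R} {a} a≉0 0∈R with Fin.any? (λ i → i Subset.∈? R ⊕ a ×-dec ¬? (i Subset.∈? R))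
  ... | yes (i , i∈R⊕a , i∉R) = inj₂ (Subset.p⊆p∪q _ , i , Subset.x∈p∪q⁺ (inj₂ i∈R⊕a) , i∉R)
  ... | no none = inj₁ (Subset.⊆-antisym Subset.⊆⊤ (λ {i} _ → closed⇒full a≉0 0∈R closed i))
    where
    closed : ∀ {x} → index x ∈ R → index (x + a) ∈ R
    closed {x} x∈R with index (x + a) Subset.∈? R
    ... | yes x+a∈R = x+a∈R
    ... | no  x+a∉R = ⊥-elim (none (_ , ∈⊕⁺ a x∈R , x+a∉R))

  subsetSums-grow : ∀ {N} (T : Subset N) u → (∀ i → ¬ u i ≈ 0#) →
                    subsetSums T u ≡ ⊤ ⊎ size T < size (subsetSums T u)
  subsetSums-grow []            u u≉0 = inj₂ (≡.subst (0 <_) (≡.sym (Subset.∣⁅x⁆∣≡1 (index 0#))) ℕ.z<s)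
  subsetSums-grow (outside ∷ T) u u≉0 = subsetSums-grow T (u ∘ suc) (u≉0 ∘ suc)
  subsetSums-grow (inside ∷ T)  u u≉0 with subsetSums-grow T (u ∘ suc) (u≉0 ∘ suc)
  ... | inj₁ R≡⊤ = inj₁ (≡.trans (≡.cong (λ R → R ∪ (R ⊕ u zero)) R≡⊤) (Subset.∪-zeroˡ _))
  ... | inj₂ T<R with ⊕-grows (u≉0 zero) (0∈subsetSums T (u ∘ suc))
  ...   | inj₁ R≡⊤ = inj₁ (≡.trans (≡.cong (λ R → R ∪ (R ⊕ u zero)) R≡⊤) (Subset.∪-zeroˡ _))
  ...   | inj₂ R⊂R∪R⊕a = inj₂ (ℕ.≤-<-trans T<R (Subset.p⊂q⇒∣p∣<∣q∣ R⊂R∪R⊕a))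

  subsetSums≡⊤ : ∀ {N} (T : Subset N) u → (∀ i → ¬ u i ≈ 0#) → p ∸ 1 ≤ size T → subsetSums T u ≡ ⊤
  subsetSums≡⊤ T u u≉0 p-1≤T with subsetSums-grow T u u≉0
  ... | inj₁ R≡⊤ = R≡⊤
  ... | inj₂ T<R = Subset.∣p∣≡n⇒p≡⊤ (ℕ.≤-antisym (Subset.∣p∣≤n (subsetSums T u))
                     (ℕ.≤-trans (ℕ.m≤n+m∸n p 1) (ℕ.≤-trans (s≤s p-1≤T) T<R)))

  subsetSums-cover : ∀ {N} (T : Subset N) u → (∀ i → ¬ u i ≈ 0#) → p ∸ 1 ≤ size T → SubsetSumsCover T u
  subsetSums-cover T u u≉0 p-1≤T t
    with subsetSums-sound T u (≡.subst (index t ∈_) (≡.sym (subsetSums≡⊤ T u u≉0 p-1≤T)) Subset.∈⊤)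
  ... | A , A⊆T , ∑A≈t = A , A⊆T , trans ∑A≈t (element-index t)

-- {b_k : k ∉ J} ∪ {c_j : j ∈ J}; the middle entry outside is the tip t.
switched : ∀ {n} → Subset n → Subset (Ground n)
switched J = ∁ J ++ (outside ∷ J)

module SpecialStandard {c ℓ : Level} (K : Field c ℓ) {n : ℕ}
  (A : Matrix K n (Ground n)) (x : Fin n → Field.Carrier K) (A-ssr : IsSpecialStandard K A x) where

  open Field K
  open FieldProperties K
  open import Relation.Binary.Reasoning.Setoid setoid
  open GroupProperties +-group using (inverseʳ-unique; ⁻¹-involutive; ε⁻¹≈ε)
  open RingProperties ring using (-‿distribˡ-*)

  A-b : ∀ row k → A row (bE k) ≈ unit K k row
  A-b row k = trans (proj₂ A-ssr row (bE k)) (reflexive (entry-b row k))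
    where
    entry-b : ∀ row k → ssrEntry K x row (bE k) ≡ unit K k row
    entry-b row k rewrite Fin.splitAt-↑ˡ n k (suc n) = ≡.refl

  A-c : ∀ row j → A row (cE j) ≈ 1# + x j * unit K j row
  A-c row j = trans (proj₂ A-ssr row (cE j)) (reflexive (entry-c row j))
    where
    entry-c : ∀ row j → ssrEntry K x row (cE j) ≡ 1# + x j * unit K j row
    entry-c row j rewrite Fin.splitAt-↑ʳ n (suc n) (suc j) = ≡.refl

  row-∑∈-switched : ∀ J (l : Fin (Ground n) → Carrier) r →
    ∑∈ (switched J) (λ g → l g * A r g) ≈
    (if not (lookup J r) then l (bE r) else 0#) + (∑∈ J (l ∘ cE) + (if lookup J r then l (cE r) * x r else 0#))
  row-∑∈-switched J l r = begin
    ∑∈ (switched J) (λ g → l g * A r g)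
      ≈⟨ ∑∈-++ (∁ J) (outside ∷ J) _ ⟩
    ∑∈ (∁ J) (λ k → l (bE k) * A r (bE k)) + (0# + ∑∈ J (λ j → l (cE j) * A r (cE j)))
      ≈⟨ +-cong b-part (trans (+-identityˡ _) c-part) ⟩
    (if not (lookup J r) then l (bE r) else 0#) + (∑∈ J (l ∘ cE) + (if lookup J r then l (cE r) * x r else 0#)) ∎
    where
    b-part : ∑∈ (∁ J) (λ k → l (bE k) * A r (bE k)) ≈ (if not (lookup J r) then l (bE r) else 0#)
    b-part = begin
      ∑∈ (∁ J) (λ k → l (bE k) * A r (bE k))   ≈⟨ ∑∈-cong (∁ J) (λ {k} _ → *-congˡ (A-b r k)) ⟩
      ∑∈ (∁ J) (λ k → l (bE k) * unit K k r)   ≈⟨ ∑∈-unit (∁ J) (l ∘ bE) r ⟩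
      (if lookup (∁ J) r then l (bE r) else 0#)
        ≡⟨ ≡.cong (λ b → if b then l (bE r) else 0#) (Vec.lookup-map r not J) ⟩
      (if not (lookup J r) then l (bE r) else 0#) ∎
    expand : ∀ j → l (cE j) * A r (cE j) ≈ l (cE j) + (l (cE j) * x j) * unit K j r
    expand j = begin
      l (cE j) * A r (cE j)                         ≈⟨ *-congˡ (A-c r j) ⟩
      l (cE j) * (1# + x j * unit K j r)            ≈⟨ distribˡ _ _ _ ⟩
      l (cE j) * 1# + l (cE j) * (x j * unit K j r) ≈⟨ +-cong (*-identityʳ _) (sym (*-assoc _ _ _)) ⟩
      l (cE j) + (l (cE j) * x j) * unit K j r      ∎
    c-part : ∑∈ J (λ j → l (cE j) * A r (cE j)) ≈ ∑∈ J (l ∘ cE) + (if lookup J r then l (cE r) * x r else 0#)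
    c-part = begin
      ∑∈ J (λ j → l (cE j) * A r (cE j))
        ≈⟨ ∑∈-cong J (λ {j} _ → expand j) ⟩
      ∑∈ J (λ j → l (cE j) + (l (cE j) * x j) * unit K j r)
        ≈⟨ ∑∈-distrib-+ J _ _ ⟩
      ∑∈ J (l ∘ cE) + ∑∈ J (λ j → (l (cE j) * x j) * unit K j r)
        ≈⟨ +-congˡ (∑∈-unit J (λ j → l (cE j) * x j) r) ⟩
      ∑∈ J (l ∘ cE) + (if lookup J r then l (cE r) * x r else 0#) ∎

  dependency : Fin (Ground n) → Carrier
  dependency g = [ (λ _ → 1#) , (λ { zero → 0# ; (suc j) → x j ⁻¹ }) ]′ (splitAt n g)

  dependency-b : ∀ k → dependency (bE k) ≡ 1#
  dependency-b k rewrite Fin.splitAt-↑ˡ n k (suc n) = ≡.refl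

  dependency-c : ∀ j → dependency (cE j) ≡ x j ⁻¹
  dependency-c j rewrite Fin.splitAt-↑ʳ n (suc n) (suc j) = ≡.refl

  dependency-rows : ∀ J → ∑∈ J (λ j → x j ⁻¹) ≈ - 1# →
                    ∀ r → ∑∈ (switched J) (λ g → dependency g * A r g) ≈ 0#
  dependency-rows J ∑≈-1 r = begin
    ∑∈ (switched J) (λ g → dependency g * A r g)
      ≈⟨ row-∑∈-switched J dependency r ⟩
    (if not (lookup J r) then dependency (bE r) else 0#) + (∑∈ J (dependency ∘ cE) + _)
      ≈⟨ +-congˡ (+-congʳ (trans (∑∈-cong J (λ {j} _ → reflexive (dependency-c j))) ∑≈-1)) ⟩
    (if not (lookup J r) then dependency (bE r) else 0#) + (- 1# + _)
      ≈⟨ row (lookup J r) ⟩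
    0# ∎
    where
    row : ∀ b → (if not b then dependency (bE r) else 0#) +
                (- 1# + (if b then dependency (cE r) * x r else 0#)) ≈ 0#
    row true  = begin
      0# + (- 1# + dependency (cE r) * x r) ≈⟨ +-identityˡ _ ⟩
      - 1# + dependency (cE r) * x r        ≡⟨ ≡.cong (λ d → - 1# + d * x r) (dependency-c r) ⟩
      - 1# + x r ⁻¹ * x r                   ≈⟨ +-congˡ (trans (*-comm _ _) (⁻¹-inverse _ (proj₁ A-ssr r))) ⟩
      - 1# + 1#                             ≈⟨ -‿inverseˡ 1# ⟩
      0#                                    ∎
    row false = begin
      dependency (bE r) + (- 1# + 0#)       ≡⟨ ≡.cong (_+ (- 1# + 0#)) (dependency-b r) ⟩
      1# + (- 1# + 0#)                      ≈⟨ +-congˡ (+-identityʳ _) ⟩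
      1# + - 1#                             ≈⟨ -‿inverseʳ 1# ⟩
      0#                                    ∎

  ∑x⁻¹≈-1⇒dependent : ∀ J → ∑∈ J (λ j → x j ⁻¹) ≈ - 1# → ¬ ColumnsIndependent K A (switched J)
  ∑x⁻¹≈-1⇒dependent J ∑≈-1 independent with Subset.nonempty? J
  ... | yes (j , j∈J) = x≉0⇒x⁻¹≉0 (proj₁ A-ssr j) (begin
    x j ⁻¹           ≡⟨ dependency-c j ⟨
    dependency (cE j) ≈⟨ independent dependency (dependency-rows J ∑≈-1) (cE j) (∈-++⁺ʳ (∁ J) (there j∈J)) ⟩
    0#               ∎)
  ... | no J-empty = 1≉0 (begin
    1#                       ≈⟨ ⁻¹-involutive 1# ⟨
    - (- 1#)                 ≈⟨ -‿cong ∑≈-1 ⟨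
    - ∑∈ J (λ j → x j ⁻¹)    ≈⟨ -‿cong (∑∈-zero J (λ j∈J → ⊥-elim (J-empty (_ , j∈J)))) ⟩
    - 0#                     ≈⟨ ε⁻¹≈ε ⟩
    0#                       ∎)

  module _ (J : Subset n) (∑≉-1 : ¬ ∑∈ J (λ j → x j ⁻¹) ≈ - 1#) (l : Fin (Ground n) → Carrier)
           (rows : ∀ r → ∑∈ (switched J) (λ g → l g * A r g) ≈ 0#) where

    private
      s Σ : Carrier
      s = ∑∈ J (l ∘ cE)
      Σ = ∑∈ J (λ j → x j ⁻¹)

      row : ∀ r {b} → lookup J r ≡ b →
            (if not b then l (bE r) else 0#) + (s + (if b then l (cE r) * x r else 0#)) ≈ 0#
      row r ≡.refl = trans (sym (row-∑∈-switched J l r)) (rows r)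

      lookup≡false : ∀ {k} → k ∉ J → lookup J k ≡ false
      lookup≡false {k} k∉J with lookup J k in eq
      ... | true  = contradiction (Vec.lookup⇒[]= k J eq) k∉J
      ... | false = ≡.refl

      c-value : ∀ {j} → j ∈ J → l (cE j) ≈ - s * x j ⁻¹
      c-value {j} j∈J = begin
        l (cE j)                    ≈⟨ *-identityʳ _ ⟨
        l (cE j) * 1#               ≈⟨ *-congˡ (⁻¹-inverse (x j) (proj₁ A-ssr j)) ⟨
        l (cE j) * (x j * x j ⁻¹)   ≈⟨ *-assoc _ _ _ ⟨
        (l (cE j) * x j) * x j ⁻¹   ≈⟨ *-congʳ (inverseʳ-unique s _ s+cx≈0) ⟩
        - s * x j ⁻¹                ∎
        where
        s+cx≈0 : s + l (cE j) * x j ≈ 0#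
        s+cx≈0 = trans (sym (+-identityˡ _)) (row j (Vec.[]=⇒lookup j∈J))

      -- Summing the c-values over J gives s = -s·Σ, i.e. (1 + Σ)·s = 0.
      s≈0 : s ≈ 0#
      s≈0 = x≉0∧x*y≈0⇒y≈0 (λ 1+Σ≈0 → ∑≉-1 (inverseʳ-unique 1# Σ 1+Σ≈0)) (begin
        (1# + Σ) * s           ≈⟨ distribʳ s 1# Σ ⟩
        1# * s + Σ * s         ≈⟨ +-cong (*-identityˡ s) (*-comm Σ s) ⟩
        s + s * Σ              ≈⟨ +-congʳ s≈-sΣ ⟩
        - s * Σ + s * Σ        ≈⟨ +-congʳ (-‿distribˡ-* s Σ) ⟨
        - (s * Σ) + s * Σ      ≈⟨ -‿inverseˡ _ ⟩
        0#                     ∎)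
        where
        s≈-sΣ : s ≈ - s * Σ
        s≈-sΣ = trans (∑∈-cong J c-value) (sym (*-distribˡ-∑∈ J (- s) (λ j → x j ⁻¹)))

      c-vanishes : ∀ {j} → j ∈ J → l (cE j) ≈ 0#
      c-vanishes {j} j∈J = begin
        l (cE j)        ≈⟨ c-value j∈J ⟩
        - s * x j ⁻¹    ≈⟨ *-congʳ (trans (-‿cong s≈0) ε⁻¹≈ε) ⟩
        0# * x j ⁻¹     ≈⟨ zeroˡ _ ⟩
        0#              ∎

      b-vanishes : ∀ {k} → k ∉ J → l (bE k) ≈ 0#
      b-vanishes {k} k∉J = begin
        l (bE k)              ≈⟨ +-identityʳ _ ⟨
        l (bE k) + 0#         ≈⟨ +-congˡ (trans (+-identityʳ s) s≈0) ⟨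
        l (bE k) + (s + 0#)   ≈⟨ row k (lookup≡false k∉J) ⟩
        0#                    ∎

    ∑x⁻¹≉-1⇒independent : ∀ g → g ∈ switched J → l g ≈ 0#
    ∑x⁻¹≉-1⇒independent g g∈ with ∈-++⁻ (∁ J) (outside ∷ J) g∈
    ... | inj₁ (k , k∈∁J , ≡.refl)           = b-vanishes (Subset.x∈∁p⇒x∉p k∈∁J)
    ... | inj₂ (suc j , there j∈J , ≡.refl) = c-vanishes j∈J

module SumTransfer {a b c d : Level} (K₁ : Field a b) (K₂ : Field c d) {n : ℕ}
  (u : Fin n → Field.Carrier K₁) (v : Fin n → Field.Carrier K₂) (U : Subset n)
  (zero-transfer : ∀ J → J ⊆ U → Field._≈_ K₁ (Field.∑∈ K₁ J u) (Field.0# K₁) →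
                                  Field._≈_ K₂ (Field.∑∈ K₂ J v) (Field.0# K₂))
  (minus-one-transfer : ∀ J → J ⊆ U → Field._≈_ K₁ (Field.∑∈ K₁ J u) (Field.-_ K₁ (Field.1# K₁)) →
                                        Field._≈_ K₂ (Field.∑∈ K₂ J v) (Field.-_ K₂ (Field.1# K₂)))
  {D E : Subset n} (D⊆U : D ⊆ U) (E⊆U : E ⊆ U) (D∩E=∅ : Disjoint D E)
  (D-covers : FieldProperties.SubsetSumsCover K₁ D u) (E-covers : FieldProperties.SubsetSumsCover K₁ E u)
  where

  private
    module F₁ = Field K₁
    module F₂ = Field K₂
    module P₁ = FieldProperties K₁
    module P₂ = FieldProperties K₂
    module G₁ = GroupProperties F₁.+-group
    module G₂ = GroupProperties F₂.+-group

  NegativeTransfer : ℕ → Set (b ⊔ d)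
  NegativeTransfer k = ∀ K → K ⊆ E → F₁._≈_ (F₁.∑∈ K u) (F₁.- F₁.fromℕ k) →
                                     F₂._≈_ (F₂.∑∈ K v) (F₂.- F₂.fromℕ k)

  -- Complete I by a subset K of E summing to -k; then I ∪ K sums to zero on both sides.
  negative⇒positive : ∀ k → NegativeTransfer k →
    ∀ I → I ⊆ U → Disjoint I E → F₁._≈_ (F₁.∑∈ I u) (F₁.fromℕ k) → F₂._≈_ (F₂.∑∈ I v) (F₂.fromℕ k)
  negative⇒positive k negative I I⊆U I∩E=∅ ∑I≈k with E-covers (F₁.- F₁.fromℕ k)
  ... | K , K⊆E , ∑K≈-k = F₂.trans
    (G₂.inverseˡ-unique _ _ (F₂.trans (F₂.sym (P₂.∑∈-∪ I K v I∩K=∅)) (zero-transfer (I ∪ K) I∪K⊆U ∑I∪K≈0)))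
    (F₂.trans (F₂.-‿cong (negative K K⊆E ∑K≈-k)) (G₂.⁻¹-involutive _))
    where
    I∩K=∅ : Disjoint I K
    I∩K=∅ i∈I = I∩E=∅ i∈I ∘ K⊆E
    I∪K⊆U : I ∪ K ⊆ U
    I∪K⊆U = ⊆-∪ I⊆U (E⊆U ∘ K⊆E)
    ∑I∪K≈0 : F₁._≈_ (F₁.∑∈ (I ∪ K) u) F₁.0#
    ∑I∪K≈0 = F₁.trans (P₁.∑∈-∪ I K u I∩K=∅) (F₁.trans (F₁.+-cong ∑I≈k ∑K≈-k) (F₁.-‿inverseʳ _))

  -- For -(1+k): add to K a subset A of D summing to k, known to transfer by the case k.
  negative-transfer : ∀ k → NegativeTransfer k
  negative-transfer zero    K K⊆E ∑K≈-0 =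
    F₂.trans (zero-transfer K (E⊆U ∘ K⊆E) (F₁.trans ∑K≈-0 G₁.ε⁻¹≈ε)) (F₂.sym G₂.ε⁻¹≈ε)
  negative-transfer (suc k) K K⊆E ∑K≈-[1+k] with D-covers (F₁.fromℕ k)
  ... | A , A⊆D , ∑A≈k = G₂.∙-cancelˡ (F₂.fromℕ k) _ _ (begin
    F₂.fromℕ k F₂.+ F₂.∑∈ K v                 ≈⟨ F₂.+-congʳ ∑₂A≈k ⟨
    F₂.∑∈ A v F₂.+ F₂.∑∈ K v                  ≈⟨ P₂.∑∈-∪ A K v A∩K=∅ ⟨
    F₂.∑∈ (A ∪ K) v                           ≈⟨ minus-one-transfer (A ∪ K) A∪K⊆U ∑₁A∪K≈-1 ⟩
    F₂.- F₂.1#                                ≈⟨ P₂.x+-[1+x]≈-1 (F₂.fromℕ k) ⟨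
    F₂.fromℕ k F₂.+ F₂.- F₂.fromℕ (suc k)     ∎)
    where
    open import Relation.Binary.Reasoning.Setoid F₂.setoid
    A∩K=∅ : Disjoint A K
    A∩K=∅ a∈A = D∩E=∅ (A⊆D a∈A) ∘ K⊆E
    A∪K⊆U : A ∪ K ⊆ U
    A∪K⊆U = ⊆-∪ (D⊆U ∘ A⊆D) (E⊆U ∘ K⊆E)
    ∑₂A≈k : F₂._≈_ (F₂.∑∈ A v) (F₂.fromℕ k)
    ∑₂A≈k = negative⇒positive k (negative-transfer k) A (D⊆U ∘ A⊆D) (D∩E=∅ ∘ A⊆D) ∑A≈k
    ∑₁A∪K≈-1 : F₁._≈_ (F₁.∑∈ (A ∪ K) u) (F₁.- F₁.1#)
    ∑₁A∪K≈-1 = F₁.trans (P₁.∑∈-∪ A K u A∩K=∅)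
                 (F₁.trans (F₁.+-cong ∑A≈k ∑K≈-[1+k]) (P₁.x+-[1+x]≈-1 (F₁.fromℕ k)))

  positive-transfer : ∀ k I → I ⊆ U → Disjoint I E →
                      F₁._≈_ (F₁.∑∈ I u) (F₁.fromℕ k) → F₂._≈_ (F₂.∑∈ I v) (F₂.fromℕ k)
  positive-transfer k = negative⇒positive k (negative-transfer k)

module TwoRepresentations {a b c d : Level} {n : ℕ} {M : Matroid (Ground n)}
  (K₁ : Field a b) {A₁ : Matrix K₁ n (Ground n)} {x : Fin n → Field.Carrier K₁}
  (A₁-ssr : IsSpecialStandard K₁ A₁ x) (A₁-rep : Represents K₁ A₁ M)
  (K₂ : Field c d) (_≟₂_ : ∀ s t → Dec (Field._≈_ K₂ s t))
  {A₂ : Matrix K₂ n (Ground n)} {y : Fin n → Field.Carrier K₂}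
  (A₂-ssr : IsSpecialStandard K₂ A₂ y) (A₂-rep : Represents K₂ A₂ M)
  where

  private
    module F₁ = Field K₁
    module F₂ = Field K₂
    module P₁ = FieldProperties K₁
    module P₂ = FieldProperties K₂
    module S₁ = SpecialStandard K₁ A₁ x A₁-ssr
    module S₂ = SpecialStandard K₂ A₂ y A₂-ssr
    module G₂ = GroupProperties F₂.+-group

  u : Fin n → F₁.Carrier
  u i = x i F₁.⁻¹

  v : Fin n → F₂.Carrier
  v i = y i F₂.⁻¹

  minus-one-transfer : ∀ J → F₁._≈_ (F₁.∑∈ J u) (F₁.- F₁.1#) → F₂._≈_ (F₂.∑∈ J v) (F₂.- F₂.1#)
  minus-one-transfer J ∑u≈-1 with F₂.∑∈ J v ≟₂ (F₂.- F₂.1#)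
  ... | yes ∑v≈-1 = ∑v≈-1
  ... | no  ∑v≉-1 = ⊥-elim (S₁.∑x⁻¹≈-1⇒dependent J ∑u≈-1
          (proj₁ (A₁-rep (switched J)) (proj₂ (A₂-rep (switched J)) (S₂.∑x⁻¹≉-1⇒independent J ∑v≉-1))))

  module _ (o : Fin n) (x-o≈-1 : F₁._≈_ (x o) (F₁.- F₁.1#)) where

    v-o≈-1 : F₂._≈_ (v o) (F₂.- F₂.1#)
    v-o≈-1 = F₂.trans (F₂.sym (P₂.∑∈-⁅⁆ o v))
               (minus-one-transfer ⁅ o ⁆ (F₁.trans (P₁.∑∈-⁅⁆ o u) (P₁.x≈-1⇒x⁻¹≈-1 x-o≈-1)))

    zero-transfer : ∀ J → J ⊆ ∁ ⁅ o ⁆ → F₁._≈_ (F₁.∑∈ J u) F₁.0# → F₂._≈_ (F₂.∑∈ J v) F₂.0#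
    zero-transfer J J⊆U ∑u≈0 = G₂.∙-cancelˡ (v o) _ _ (begin
      v o F₂.+ F₂.∑∈ J v           ≈⟨ F₂.+-congʳ (P₂.∑∈-⁅⁆ o v) ⟨
      F₂.∑∈ ⁅ o ⁆ v F₂.+ F₂.∑∈ J v  ≈⟨ P₂.∑∈-∪ ⁅ o ⁆ J v o∩J=∅ ⟨
      F₂.∑∈ (⁅ o ⁆ ∪ J) v          ≈⟨ minus-one-transfer (⁅ o ⁆ ∪ J) ∑u≈-1 ⟩
      F₂.- F₂.1#                   ≈⟨ v-o≈-1 ⟨
      v o                          ≈⟨ F₂.+-identityʳ _ ⟨
      v o F₂.+ F₂.0#               ∎)
      where
      open import Relation.Binary.Reasoning.Setoid F₂.setoid
      o∩J=∅ : Disjoint ⁅ o ⁆ J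
      o∩J=∅ i∈⁅o⁆ i∈J with Subset.x∈⁅y⁆⇒x≡y o i∈⁅o⁆
      ... | ≡.refl = Subset.x∈∁p⇒x∉p (J⊆U i∈J) (Subset.x∈⁅x⁆ o)
      ∑u≈-1 : F₁._≈_ (F₁.∑∈ (⁅ o ⁆ ∪ J) u) (F₁.- F₁.1#)
      ∑u≈-1 = F₁.trans (P₁.∑∈-∪ ⁅ o ⁆ J u o∩J=∅) (F₁.trans (F₁.+-cong (P₁.∑∈-⁅⁆ o u) ∑u≈0)
                (F₁.trans (F₁.+-identityʳ _) (P₁.x≈-1⇒x⁻¹≈-1 x-o≈-1)))

  module _ {p : ℕ} (p-prime : Prime p) (K₁-size : HasSize K₁ p)
           (o : Fin n) (x-o≈-1 : F₁._≈_ (x o) (F₁.- F₁.1#))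
           (2[p-1]≤∣U∣ : (p ∸ 1) ℕ.+ (p ∸ 1) ≤ size (∁ ⁅ o ⁆)) where

    private
      module GFp = PrimeField K₁ p-prime K₁-size

      u≉0 : ∀ i → ¬ F₁._≈_ (u i) F₁.0#
      u≉0 i = P₁.x≉0⇒x⁻¹≉0 (proj₁ A₁-ssr i)

    natural-sum-transfer : ∀ I → I ⊆ ∁ ⁅ o ⁆ → size I ≤ p ∸ 1 →
      ∀ k → F₁._≈_ (F₁.∑∈ I u) (F₁.fromℕ k) → F₂._≈_ (F₂.∑∈ I v) (F₂.fromℕ k)
    natural-sum-transfer I I⊆U ∣I∣≤p-1 k with disjointBlocks (∁ ⁅ o ⁆) I 2[p-1]≤∣U∣ ∣I∣≤p-1
    ... | D , E , D⊆U , E⊆U , D∩E=∅ , I∩E=∅ , ∣D∣≥p-1 , ∣E∣≥p-1 = T.positive-transfer k I I⊆U I∩E=∅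
      where
      module T = SumTransfer K₁ K₂ u v (∁ ⁅ o ⁆) (zero-transfer o x-o≈-1) (λ J _ → minus-one-transfer J)
                   D⊆U E⊆U D∩E=∅ (GFp.subsetSums-cover D u u≉0 ∣D∣≥p-1)
                   (GFp.subsetSums-cover E u u≉0 ∣E∣≥p-1)

    fromℕ[p]≈0 : F₂._≈_ (F₂.fromℕ p) F₂.0#
    fromℕ[p]≈0 = F₂.trans (F₂.sym ∑⊥≈p) (P₂.∑∈-⊥ v)
      where
      ∑⊥≈p : F₂._≈_ (F₂.∑∈ ⊥ v) (F₂.fromℕ p)
      ∑⊥≈p = natural-sum-transfer ⊥ (⊥-elim ∘ Subset.∉⊥) (≡.subst (_≤ _) (≡.sym (Subset.∣⊥∣≡0 n)) z≤n) p
               (F₁.trans (P₁.∑∈-⊥ u) (F₁.sym GFp.fromℕ[p]≈0))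

    integer-sum-transfer : ∀ I → I ⊆ ∁ ⁅ o ⁆ → size I ≤ p ∸ 1 →
      ∀ m → ℤ.∣ m ∣ ≤ p → F₁._≈_ (F₁.∑∈ I u) (F₁.fromℤ m) → F₂._≈_ (F₂.∑∈ I v) (F₂.fromℤ m)
    integer-sum-transfer I I⊆U ∣I∣≤p-1 m ∣m∣≤p ∑I≈m = F₂.trans
      (natural-sum-transfer I I⊆U ∣I∣≤p-1 (residue p m)
        (F₁.trans ∑I≈m (P₁.fromℤ≈fromℕ-residue GFp.fromℕ[p]≈0 m ∣m∣≤p)))
      (F₂.sym (P₂.fromℤ≈fromℕ-residue fromℕ[p]≈0 m ∣m∣≤p))

open import Data.Nat using (_*_; _/_)
open import Data.Integer using (∣_∣; 0ℤ)
open import Data.Nat.DivMod using (m/n≤m)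
open import Data.Nat.Primality using (prime⇒nonZero)

2*p∸1≤n⇒0<n×[p∸1]+[p∸1]≤n∸1 : ∀ p {n} → 0 < p → 2 * p ∸ 1 ≤ n → 0 < n × (p ∸ 1) ℕ.+ (p ∸ 1) ≤ n ∸ 1
2*p∸1≤n⇒0<n×[p∸1]+[p∸1]≤n∸1 (suc q) {n} _ 2p-1≤n = ℕ.<-≤-trans ℕ.z<s 1+2q≤n , ℕ.∸-monoˡ-≤ 1 1+2q≤n
  where
  1+2q≤n : suc (q ℕ.+ q) ≤ n
  1+2q≤n = ≡.subst (_≤ n)
    (≡.trans (ℕ.+-suc q (q ℕ.+ 0)) (≡.cong (λ r → suc (q ℕ.+ r)) (ℕ.+-identityʳ q))) 2p-1≤n

proposition3p1 :
    ∀ {a b c d : Level}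
    (p : ℕ) → Prime p → p ≢ 2 →
    (n : ℕ) → 2 * p ∸ 1 ≤ n →
    (M : Matroid (Ground n)) → IsSpike n M →
    IsBasis M (DistBasis n) →
    (GFp : Field a b) → HasSize GFp p →
    (F : Field c d) → IsFiniteField F →
    (q : ℕ) → HasCharacteristic F q →
    (A₁ : Matrix GFp n (Ground n)) (x : Fin n → Field.Carrier GFp) →
    IsSpecialStandard GFp A₁ x → Represents GFp A₁ M →
    (∀ i → toℕ i ≡ 0 → Field._≈_ GFp (x i) (Field.-_ GFp (Field.1# GFp))) →
    (A₂ : Matrix F n (Ground n)) (y : Fin n → Field.Carrier F) →
    IsSpecialStandard F A₂ y → Represents F A₂ M →
    (m : ℤ) → m ≢ 0ℤ → ∣ m ∣ ≤ (p ∸ 1) / 2 →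
    (I : Subset n) → (∀ i → i ∈ I → 1 ≤ toℕ i) → size I ≤ p ∸ 1 →
    Field._≈_ GFp (Field.∑∈ GFp I (λ i → Field._⁻¹ GFp (x i))) (Field.fromℤ GFp m) →
    Field._≈_ F (Field.∑∈ F I (λ i → Field._⁻¹ F (y i))) (Field.fromℤ F m)
proposition3p1 p p-prime _ n 2p-1≤n M _ _ GFp GFp-size F F-finite _ _ A₁ x A₁-ssr A₁-rep x₀≈-1
               A₂ y A₂-ssr A₂-rep m _ ∣m∣≤[p-1]/2 I I-positive ∣I∣≤p-1 =
  integer-sum-transfer p-prime GFp-size o (x₀≈-1 o (Fin.toℕ-fromℕ< 0<n)) 2[p-1]≤∣U∣ I I⊆U ∣I∣≤p-1 m ∣m∣≤p
  where
  open TwoRepresentations {M = M} GFp A₁-ssr A₁-rep F (Finite._≟_ F (proj₂ F-finite)) A₂-ssr A₂-rep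
  arithmetic : 0 < n × (p ∸ 1) ℕ.+ (p ∸ 1) ≤ n ∸ 1
  arithmetic = 2*p∸1≤n⇒0<n×[p∸1]+[p∸1]≤n∸1 p (ℕ.>-nonZero⁻¹ p {{prime⇒nonZero p-prime}}) 2p-1≤n
  0<n : 0 < n
  0<n = proj₁ arithmetic
  o : Fin n
  o = Fin.fromℕ< 0<n
  2[p-1]≤∣U∣ : (p ∸ 1) ℕ.+ (p ∸ 1) ≤ size (∁ ⁅ o ⁆)
  2[p-1]≤∣U∣ = ≡.subst (_ ≤_) (≡.sym (∣∁⁅i⁆∣≡n∸1 o)) (proj₂ arithmetic)
  I⊆U : I ⊆ ∁ ⁅ o ⁆
  I⊆U {i} i∈I = Subset.x∉p⇒x∈∁p λ i∈⁅o⁆ →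
    ℕ.<⇒≢ (I-positive i i∈I) (≡.sym (≡.trans (≡.cong toℕ (Subset.x∈⁅y⁆⇒x≡y o i∈⁅o⁆))
                                              (Fin.toℕ-fromℕ< 0<n)))
  ∣m∣≤p : ∣ m ∣ ≤ p
  ∣m∣≤p = ℕ.≤-trans ∣m∣≤[p-1]/2 (ℕ.≤-trans (m/n≤m (p ∸ 1) 2) (ℕ.m∸n≤m p 1))
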